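{- For all integers $n>0$ and $k\geqslant 1$, $$(-1)^{k-1} \left( \sum_{j=0}^{k-1} (-1)^{j} p\big(n-j(3j+5)/2-1\big) - N(n) \right) \geqslant 0,$$ with strict inequality if $n\geqslant k(3k+5)/2+1$. For example, $p(n-1)\geqslant N(n)$, $p(n-1)-p(n-5)\leqslant N(n)$, $p(n-1)-p(n-5)+p(n-12)\geqslant N(n)$, and $p(n-1)-p(n-5)+p(n-12)-p(n-22)\leqslant N(n)$.
   Context: $p(n)$ denotes the number of partitions of $n$, with $p(0)=1$ and $p(n)=0$ if $n$ is not a non-negative integer. The rank of a partition is its largest part minus its number of parts. $N(n)$ denotes the number of partitions of $n$ with non-negative rank. -}

module Defs where

open import Data.Nat as ℕ using (ℕ; zero; suc; _∸_; _⊔_; _⊓_)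
open import Data.Nat.Base using (⌊_/2⌋)
open import Data.Integer as ℤ using (ℤ; +_; -[1+_]; 0ℤ; 1ℤ)
open import Data.List using (List; []; _∷_; map; concatMap; applyUpTo; length; filter; foldr)

-- A partition is represented as a weakly decreasing list of positive parts.
-- partsLE fuel n m : all partitions of n into parts each ≤ m, listed once each
-- (choose the largest part k ∈ {1,…,min m n}, then partition n ∸ k into parts ≤ k).
-- The fuel argument only ensures structural termination; fuel n suffices since
-- every part is ≥ 1.
partsLE : ℕ → ℕ → ℕ → List (List ℕ)
partsLE _        zero    _ = [] ∷ []
partsLE zero     (suc _) _ = []
partsLE (suc f) (suc n) m =
  concatMap (λ k → map (k ∷_) (partsLE f (suc n ∸ k) k))
            (applyUpTo suc (m ⊓ suc n))

partitions : ℕ → List (List ℕ)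
partitions n = partsLE n n n

p : ℕ → ℕ
p n = length (partitions n)

pℤ : ℤ → ℕ
pℤ (+ n)    = p n
pℤ -[1+ _ ] = 0

largestPart : List ℕ → ℕ
largestPart = foldr _⊔_ 0

rank : List ℕ → ℤ
rank λs = + largestPart λs ℤ.- + length λs

N : ℕ → ℕ
N n = length (filter (λ λs → 0ℤ ℤ.≤? rank λs) (partitions n))

-- j(3j+5)/2 (always an integer)
g : ℕ → ℕ
g j = ⌊ j ℕ.* (3 ℕ.* j ℕ.+ 5) /2⌋

S : ℕ → ℕ → ℤ
S n zero    = 0ℤ
S n (suc k) = S n k ℤ.+ (ℤ.- 1ℤ) ℤ.^ k ℤ.* + pℤ (+ n ℤ.- + g k ℤ.- 1ℤ)

module Submission where

-- Write  N≥ m x  for the number of partitions of x with rank at least m, so that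
-- N = N≥ 0 on positive integers.  Everything rests on one identity between rank
-- counts (the "key identity")
--     N≥ m (y + m + 1)  +  N≥ (m + 3) y  =  p(y).
-- Since g (k + 1) = g k + (3k + 4), an induction on k turns it into the exact formula
--     (-1)^k · (S n (k + 1) - N n)  =  N≥ (3k + 3) (n - g k - 1),
-- whose right-hand side is a count, hence ≥ 0, and is positive as soon as the
-- partition of n - g k - 1 into one part has rank ≥ 3k + 3, i.e. n ≥ g (k + 1) + 1.

open import Defs
open import Data.Nat as ℕ using (ℕ; zero; suc; _+_; _*_; _∸_; _≤_; _<_; _≤?_; _⊔_; _⊓_; z≤n; s≤s; z<s; ⌊_/2⌋)
open import Data.Nat.Properties
open import Data.Nat.Tactic.RingSolver using (solve-∀)
open import Data.Integer as ℤ using (ℤ; +_; 0ℤ; 1ℤ; _⊖_)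
import Data.Integer.Properties as ℤP
import Data.Integer.Tactic.RingSolver as ℤSolver
open import Data.List using (List; []; _∷_; map; concatMap; applyUpTo; length; filter)
open import Data.List.Properties using (length-++; filter-++; filter-all)
open import Data.List.Relation.Unary.All as All using (All; []; _∷_)
open import Data.List.Relation.Unary.All.Properties using (applyUpTo⁺₁; map⁺; concat⁺)
open import Data.Product using (_×_; _,_)
open import Data.Bool using (true; false)
open import Function.Bundles using (mk⇔)
open import Level using (0ℓ)
open import Relation.Binary.PropositionalEquality
open import Relation.Nullary using (yes; no; does)
open import Relation.Nullary.Decidable using (does-⇔)
open import Relation.Unary using (Pred; Decidable)

-- Finite sums over an initial segment of ℕ

Σ : ℕ → (ℕ → ℕ) → ℕ
Σ zero    f = 0
Σ (suc M) f = f 0 + Σ M (λ i → f (suc i))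

Σ-last : ∀ M f → Σ (suc M) f ≡ Σ M f + f M
Σ-last zero    f = +-comm (f 0) 0
Σ-last (suc M) f = trans (cong (λ t → f 0 + t) (Σ-last M (λ i → f (suc i))))
                         (sym (+-assoc (f 0) _ _))

Σ-ext : ∀ M {f h} → (∀ i → i < M → f i ≡ h i) → Σ M f ≡ Σ M h
Σ-ext zero    eq = refl
Σ-ext (suc M) eq = cong₂ _+_ (eq 0 z<s) (Σ-ext M (λ i i<M → eq (suc i) (s≤s i<M)))

Σ-+ : ∀ M f h → Σ M (λ i → f i + h i) ≡ Σ M f + Σ M h
Σ-+ zero    f h = refl
Σ-+ (suc M) f h = trans (cong (λ t → f 0 + h 0 + t) (Σ-+ M _ _)) (interchange (f 0) (h 0) _ _)
  where
  interchange : ∀ a b c d → a + b + (c + d) ≡ a + c + (b + d)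
  interchange = solve-∀

Σ-zero : ∀ M f → (∀ i → f i ≡ 0) → Σ M f ≡ 0
Σ-zero zero    f zero-f = refl
Σ-zero (suc M) f zero-f = cong₂ _+_ (zero-f 0) (Σ-zero M _ (λ i → zero-f (suc i)))

Σ-vanishing : ∀ M K f → (∀ i → M ≤ i → f i ≡ 0) → Σ (M + K) f ≡ Σ M f
Σ-vanishing zero    K f zero-f = Σ-zero K f (λ i → zero-f i z≤n)
Σ-vanishing (suc M) K f zero-f =
  cong (λ t → f 0 + t) (Σ-vanishing M K _ (λ i M≤i → zero-f (suc i) (s≤s M≤i)))

Σ-⊓ : ∀ a M f → (∀ i → M ≤ i → f i ≡ 0) → Σ (a ⊓ M) f ≡ Σ a f
Σ-⊓ a M f zero-f with a ≤? M
... | yes a≤M = cong (λ t → Σ t f) (m≤n⇒m⊓n≡m a≤M)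
... | no  a≰M = begin
    Σ (a ⊓ M) f         ≡⟨ cong (λ t → Σ t f) (m≥n⇒m⊓n≡n M≤a) ⟩
    Σ M f               ≡⟨ Σ-vanishing M (a ∸ M) f zero-f ⟨
    Σ (M + (a ∸ M)) f   ≡⟨ cong (λ t → Σ t f) (m+[n∸m]≡n M≤a) ⟩
    Σ a f               ∎
  where
  open ≡-Reasoning
  M≤a = <⇒≤ (≰⇒> a≰M)

Σ-dropLast : ∀ M f → f M ≡ 0 → Σ (suc M) f ≡ Σ M f
Σ-dropLast M f fM≡0 = trans (Σ-last M f) (trans (cong (λ t → Σ M f + t) fM≡0) (+-identityʳ _))

term≤Σ : ∀ M f j → j < M → f j ≤ Σ M f
term≤Σ (suc M) f zero    j<M       = m≤m+n (f 0) _
term≤Σ (suc M) f (suc j) (s≤s j<M) = ≤-trans (term≤Σ M _ j j<M) (m≤n+m _ (f 0))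

-- Box numbers

δ : ℕ → ℕ → ℕ
δ zero    zero    = 1
δ zero    (suc n) = 0
δ (suc y) zero    = 0
δ (suc y) (suc n) = δ y n

-- box y n a b: the number of partitions of y - n into at most b parts, each at
-- most a (0 if n > y).  Recurrence: either all parts are < a + 1, or one part
-- equals a + 1 and it is removed.
box : ℕ → ℕ → ℕ → ℕ → ℕ
box y n zero    b       = δ y n
box y n (suc a) zero    = δ y n
box y n (suc a) (suc b) = box y n a (suc b) + box y (n + suc a) (suc a) b

δ-below : ∀ y n → y < n → δ y n ≡ 0
δ-below zero    (suc n) _         = refl
δ-below (suc y) (suc n) (s≤s y<n) = δ-below y n y<n

δ-diag : ∀ y → δ y y ≡ 1
δ-diag zero    = refl
δ-diag (suc y) = δ-diag y

δ-shift : ∀ t y n → δ (t + y) (t + n) ≡ δ y n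
δ-shift zero    y n = refl
δ-shift (suc t) y n = δ-shift t y n

box-below : ∀ y n a b → y < n → box y n a b ≡ 0
box-below y n zero    b       y<n = δ-below y n y<n
box-below y n (suc a) zero    y<n = δ-below y n y<n
box-below y n (suc a) (suc b) y<n =
  cong₂ _+_ (box-below y n a (suc b) y<n)
            (box-below y (n + suc a) (suc a) b (<-≤-trans y<n (m≤m+n n _)))

box-shift : ∀ t y n a b → box (t + y) (t + n) a b ≡ box y n a b
box-shift t y n zero    b       = δ-shift t y n
box-shift t y n (suc a) zero    = δ-shift t y n
box-shift t y n (suc a) (suc b) = cong₂ _+_ (box-shift t y n a (suc b))
  (trans (cong (λ m → box (t + y) m (suc a) b) (+-assoc t n (suc a)))
         (box-shift t y (n + suc a) (suc a) b))

box-rebase : ∀ {n y} a b → n ≤ y → box y n a b ≡ box (y ∸ n) 0 a b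
box-rebase {n} {y} a b n≤y =
  trans (cong₂ (λ u v → box u v a b) (sym (m+[n∸m]≡n n≤y)) (sym (+-identityʳ n)))
        (box-shift n (y ∸ n) 0 a b)

box-exact : ∀ y a b → box y y a b ≡ 1
box-exact y zero    b       = δ-diag y
box-exact y (suc a) zero    = δ-diag y
box-exact y (suc a) (suc b) =
  cong₂ _+_ (box-exact y a (suc b)) (box-below y (y + suc a) (suc a) b (m<m+n y z<s))

box-noParts : ∀ y n a → box y n a 0 ≡ δ y n
box-noParts y n zero    = refl
box-noParts y n (suc a) = refl

-- A part a + 1 does not fit into y - n < a + 1.
box-wide : ∀ y n a b → y < n + suc a → box y n (suc a) b ≡ box y n a b
box-wide y n a zero    _ = sym (box-noParts y n a)
box-wide y n a (suc b) y<n+a+1 =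
  trans (cong (λ t → box y n a (suc b) + t) (box-below y (n + suc a) (suc a) b y<n+a+1))
        (+-identityʳ _)

box-wider : ∀ y n a b k → y ≤ n + a → box y n (k + a) b ≡ box y n a b
box-wider y n a b zero    _     = refl
box-wider y n a b (suc k) y≤n+a = trans
  (box-wide y n (k + a) b (≤-trans (s≤s (≤-trans y≤n+a (+-monoʳ-≤ n (m≤n+m a k))))
                                   (≤-reflexive (sym (+-suc n (k + a))))))
  (box-wider y n a b k y≤n+a)

-- Second recurrence, removing the first column: either there are at most b parts,
-- or there are exactly b + 1 parts and each of them is decreased by one.
box-column : ∀ a b y n →
  box y n (suc a) (suc b) ≡ box y n (suc a) b + box y (n + suc b) a (suc b)
box-column zero zero y n = refl
box-column zero (suc b) y n = begin
    δ y n + box y (n + 1) 1 (suc b)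
  ≡⟨ cong (λ t → δ y n + t) (box-column zero b y (n + 1)) ⟩
    δ y n + (box y (n + 1) 1 b + δ y (n + 1 + suc b))
  ≡⟨ +-assoc (δ y n) _ _ ⟨
    δ y n + box y (n + 1) 1 b + δ y (n + 1 + suc b)
  ≡⟨ cong (λ m → δ y n + box y (n + 1) 1 b + δ y m) (index n b) ⟩
    δ y n + box y (n + 1) 1 b + δ y (n + suc (suc b)) ∎
  where
  open ≡-Reasoning
  index : ∀ n b → n + 1 + suc b ≡ n + suc (suc b)
  index = solve-∀
box-column (suc a) zero y n = begin
    box y n (suc a) 1 + δ y (n + suc (suc a))
  ≡⟨ cong (_+ δ y (n + suc (suc a))) (box-column a zero y n) ⟩
    δ y n + box y (n + 1) a 1 + δ y (n + suc (suc a))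
  ≡⟨ +-assoc (δ y n) _ _ ⟩
    δ y n + (box y (n + 1) a 1 + δ y (n + suc (suc a)))
  ≡⟨ cong (λ m → δ y n + (box y (n + 1) a 1 + δ y m)) (index n a) ⟩
    δ y n + (box y (n + 1) a 1 + δ y (n + 1 + suc a)) ∎
  where
  open ≡-Reasoning
  index : ∀ n a → n + suc (suc a) ≡ n + 1 + suc a
  index = solve-∀
box-column (suc a) (suc b) y n = begin
    box y n (suc a) (suc (suc b)) + box y n′ (suc (suc a)) (suc b)
  ≡⟨ cong₂ _+_ (box-column a (suc b) y n) (box-column (suc a) b y n′) ⟩
    (box y n (suc a) (suc b) + box y (n + suc (suc b)) a (suc (suc b)))
      + (box y n′ (suc (suc a)) b + box y (n′ + suc b) (suc a) (suc b))
  ≡⟨ cong (λ m → (box y n (suc a) (suc b) + box y (n + suc (suc b)) a (suc (suc b)))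
                   + (box y n′ (suc (suc a)) b + box y m (suc a) (suc b))) (index n a b) ⟩
    (box y n (suc a) (suc b) + box y (n + suc (suc b)) a (suc (suc b)))
      + (box y n′ (suc (suc a)) b + box y (n + suc (suc b) + suc a) (suc a) (suc b))
  ≡⟨ interchange (box y n (suc a) (suc b)) _ _ _ ⟩
    (box y n (suc a) (suc b) + box y n′ (suc (suc a)) b)
      + (box y (n + suc (suc b)) a (suc (suc b)) + box y (n + suc (suc b) + suc a) (suc a) (suc b)) ∎
  where
  open ≡-Reasoning
  n′ = n + suc (suc a)
  index : ∀ n a b → n + suc (suc a) + suc b ≡ n + suc (suc b) + suc a
  index = solve-∀
  interchange : ∀ p q r s → (p + q) + (r + s) ≡ (p + r) + (q + s)
  interchange = solve-∀

-- Unrolling the first recurrence: classify by the largest part i + 1 ≤ a.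
box-byLargest : ∀ y n a b → box y n a (suc b) ≡ δ y n + Σ a (λ i → box y (n + suc i) (suc i) b)
box-byLargest y n zero    b = sym (+-identityʳ _)
box-byLargest y n (suc a) b = begin
    box y n a (suc b) + G a
  ≡⟨ cong (_+ G a) (box-byLargest y n a b) ⟩
    δ y n + Σ a G + G a
  ≡⟨ +-assoc (δ y n) _ _ ⟩
    δ y n + (Σ a G + G a)
  ≡⟨ cong (λ t → δ y n + t) (Σ-last a G) ⟨
    δ y n + Σ (suc a) G ∎
  where
  open ≡-Reasoning
  G : ℕ → ℕ
  G i = box y (n + suc i) (suc i) b

-- Unrolling the second recurrence: classify by the number j ≤ J of parts.
box-byParts : ∀ y J → Σ (suc J) (λ j → box y j y j) ≡ box y 0 (suc y) J
box-byParts y zero    = trans (+-identityʳ _) (trans (box-noParts y 0 y) (sym (box-noParts y 0 (suc y))))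
box-byParts y (suc J) = trans (Σ-last (suc J) (λ j → box y j y j))
  (trans (cong (_+ box y (suc J) y (suc J)) (box-byParts y J)) (sym (box-column y J y 0)))

pBox : ℕ → ℕ
pBox y = box y 0 y y

-- Rank counts

-- N≥ m x: partitions of x > 0 with rank ≥ m.  Classified by the largest part
-- L = j + m + 1: removing it leaves at most j = L - m - 1 parts, each at most L.
N≥ : ℕ → ℕ → ℕ
N≥ m x = Σ (suc x) (λ j → box x (j + suc m) (j + suc m) j)

-- N≥⁻ c y: partitions of y with rank ≥ -(c + 1), i.e. (by conjugation) with
-- rank ≤ c + 1.  The latter are classified by their number j of parts: removing
-- the first column leaves at most j parts, each at most j + c.
N≥⁻ : ℕ → ℕ → ℕ
N≥⁻ c y = Σ (suc y) (λ j → box y j (j + c) j)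

-- Nrank c y: partitions of y of rank exactly c + 2, classified by the number i + 1
-- of parts (largest part i + c + 3); removing the first column and then the largest
-- part leaves at most i parts, each at most i + c + 2.
Nrank : ℕ → ℕ → ℕ
Nrank c y = Σ (suc y) (λ i → box y (suc i + suc (i + suc c)) (suc (i + suc c)) i)

N≥-empty : ∀ {m x} → x ≤ m → N≥ m x ≡ 0
N≥-empty {m} {x} x≤m = Σ-zero (suc x) _
  (λ j → box-below x (j + suc m) (j + suc m) j (≤-trans (s≤s x≤m) (m≤n+m _ j)))

-- The partition (x) has rank x - 1 ≥ m when x > m.
N≥-pos : ∀ {m x} → suc m ≤ x → 0 < N≥ m x
N≥-pos {m} {x} m<x = <-≤-trans (subst (0 <_) (sym one-part) z<s)
    (term≤Σ (suc x) (λ j → box x (j + suc m) (j + suc m) j) (x ∸ suc m) (s≤s (m∸n≤m x (suc m))))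
  where
  one-part : box x (x ∸ suc m + suc m) (x ∸ suc m + suc m) (x ∸ suc m) ≡ 1
  one-part = trans (cong (λ t → box x t t (x ∸ suc m)) (m∸n+n≡m m<x)) (box-exact x x (x ∸ suc m))

-- Every partition of y has rank ≥ -y.
N≥⁻-saturated : ∀ {c y} → y ≤ c → N≥⁻ c y ≡ pBox y
N≥⁻-saturated {c} {y} y≤c = begin
    Σ (suc y) (λ j → box y j (j + c) j)  ≡⟨ Σ-ext (suc y) (λ j _ → wide j) ⟩
    Σ (suc y) (λ j → box y j y j)        ≡⟨ box-byParts y y ⟩
    box y 0 (suc y) y                    ≡⟨ box-wide y 0 y y ≤-refl ⟩
    pBox y                               ∎
  where
  open ≡-Reasoning
  wide : ∀ j → box y j (j + c) j ≡ box y j y j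
  wide j = trans (cong (λ a → box y j a j) (sym (m∸n+n≡m (≤-trans y≤c (m≤n+m c j)))))
                 (box-wider y j y j (j + c ∸ y) (m≤n+m y j))

-- rank ≥ -(c+2) splits into rank ≥ -(c+1) and rank = -(c+2); the latter are
-- counted, after conjugation, by Nrank c (first recurrence, applied definitionally).
N≥⁻-step : ∀ c y → N≥⁻ (suc c) y ≡ N≥⁻ c y + Nrank c y
N≥⁻-step c y = begin
    box y 0 (suc c) 0 + Σ y (λ i → A i + B i)
  ≡⟨ cong₂ _+_ (trans (box-noParts y 0 (suc c)) (sym (box-noParts y 0 c))) (Σ-+ y A B) ⟩
    box y 0 c 0 + (Σ y A + Σ y B)
  ≡⟨ +-assoc (box y 0 c 0) _ _ ⟨
    box y 0 c 0 + Σ y A + Σ y B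
  ≡⟨ cong₂ (λ u v → box y 0 c 0 + u + v)
       (Σ-ext y (λ i _ → cong (λ a → box y (suc i) a (suc i)) (+-suc i c)))
       (sym (Σ-dropLast y B (box-below y _ (suc (y + suc c)) y (s≤s (m≤m+n y _))))) ⟩
    N≥⁻ c y + Nrank c y ∎
  where
  open ≡-Reasoning
  A B : ℕ → ℕ
  A i = box y (suc i) (i + suc c) (suc i)
  B i = box y (suc i + suc (i + suc c)) (suc (i + suc c)) i

-- rank ≥ c + 2 splits into rank ≥ c + 3 and rank = c + 2 (second recurrence).
N≥-step : ∀ c y → N≥ (2 + c) y ≡ N≥ (3 + c) y + Nrank c y
N≥-step c y = begin
    T₀ + Σ y (λ i → box y (suc (i + s3)) (suc (i + s3)) (suc i))
  ≡⟨ cong (λ t → T₀ + t) (Σ-ext y (λ i _ → box-column (i + s3) i y (suc (i + s3)))) ⟩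
    T₀ + Σ y (λ i → H i + K i)
  ≡⟨ cong (λ t → T₀ + t) (Σ-+ y H K) ⟩
    T₀ + (Σ y H + Σ y K)
  ≡⟨ swap T₀ (Σ y H) (Σ y K) ⟩
    Σ y H + (T₀ + Σ y K)
  ≡⟨ cong₂ _+_ higher exact ⟩
    N≥ (3 + c) y + Nrank c y ∎
  where
  open ≡-Reasoning
  s3 = 3 + c
  T₀ = box y s3 s3 0
  H K : ℕ → ℕ
  H i = box y (suc (i + s3)) (suc (i + s3)) i
  K i = box y (suc (i + s3) + suc i) (i + s3) (suc i)
  swap : ∀ a b c → a + (b + c) ≡ b + (a + c)
  swap = solve-∀
  offset : ∀ i c → suc (i + (3 + c)) + suc i ≡ suc (suc i) + suc (suc i + suc c)
  offset = solve-∀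
  bound : ∀ i c → i + (3 + c) ≡ suc (suc i + suc c)
  bound = solve-∀
  higher : Σ y H ≡ N≥ (3 + c) y
  higher = trans (Σ-ext y (λ i _ → cong (λ m → box y m m i) (sym (+-suc i s3))))
                 (sym (Σ-dropLast y _ (box-below y (y + suc s3) (y + suc s3) y (m<m+n y z<s))))
  exact : T₀ + Σ y K ≡ Nrank c y
  exact = cong₂ _+_ (trans (box-noParts y s3 s3) (sym (box-noParts y s3 (suc (suc c)))))
                    (Σ-ext y (λ i _ → cong₂ (λ n a → box y n a (suc i)) (offset i c) (bound i c)))

-- Moving from c to c + 1 transfers the partitions of rank c + 2 from one count to
-- the other (the two counts of rank ±(c + 2) agree by conjugation).
rank-transfer : ∀ c y → N≥⁻ (suc c) y + N≥ (3 + c) y ≡ N≥⁻ c y + N≥ (2 + c) y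
rank-transfer c y = begin
    N≥⁻ (suc c) y + N≥ (3 + c) y        ≡⟨ cong (_+ N≥ (3 + c) y) (N≥⁻-step c y) ⟩
    N≥⁻ c y + Nrank c y + N≥ (3 + c) y  ≡⟨ rearrange (N≥⁻ c y) _ _ ⟩
    N≥⁻ c y + (N≥ (3 + c) y + Nrank c y) ≡⟨ cong (λ t → N≥⁻ c y + t) (N≥-step c y) ⟨
    N≥⁻ c y + N≥ (2 + c) y              ∎
  where
  open ≡-Reasoning
  rearrange : ∀ a b c → a + b + c ≡ a + (c + b)
  rearrange = solve-∀

-- Every partition of y has either rank ≥ -(c + 1) or rank ≤ -(c + 2), and the
-- latter are equinumerous with rank ≥ c + 2.  Proved by telescoping with
-- rank-transfer up to some c ≥ y, where the second count is 0.
rank-complement : ∀ c y → N≥⁻ c y + N≥ (2 + c) y ≡ pBox y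
rank-complement c y = telescope y c (m≤m+n y c)
  where
  telescope : ∀ d c → y ≤ d + c → N≥⁻ c y + N≥ (2 + c) y ≡ pBox y
  telescope zero    c y≤c   = trans (cong₂ _+_ (N≥⁻-saturated y≤c) (N≥-empty (≤-trans y≤c (m≤n+m c 2))))
                                    (+-identityʳ _)
  telescope (suc d) c y≤d+c = trans (sym (rank-transfer c y))
                                    (telescope d (suc c) (≤-trans y≤d+c (≤-reflexive (sym (+-suc d c)))))

-- Removing m + 1 from the largest part, then conjugating, identifies the partitions
-- of y + m + 1 of rank ≥ m with the partitions of y of rank ≥ -(m + 2).
N≥-shift : ∀ m y → N≥ m (y + suc m) ≡ N≥⁻ (suc m) y
N≥-shift m y = begin
    Σ (suc y + suc m) f  ≡⟨ Σ-vanishing (suc y) (suc m) f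
                              (λ j y<j → box-below (y + suc m) (j + suc m) (j + suc m) j (+-monoˡ-< (suc m) y<j)) ⟩
    Σ (suc y) f          ≡⟨ Σ-ext (suc y) (λ j _ → normalise j) ⟩
    N≥⁻ (suc m) y        ∎
  where
  open ≡-Reasoning
  f : ℕ → ℕ
  f j = box (y + suc m) (j + suc m) (j + suc m) j
  normalise : ∀ j → f j ≡ box y j (j + suc m) j
  normalise j = trans (cong₂ (λ u v → box u v (j + suc m) j) (+-comm y (suc m)) (+-comm j (suc m)))
                      (box-shift (suc m) y j (j + suc m) j)

key-identity : ∀ m y → N≥ m (y + suc m) + N≥ (3 + m) y ≡ pBox y
key-identity m y = trans (cong (_+ N≥ (3 + m) y) (N≥-shift m y)) (rank-complement (suc m) y)

-- Counting the enumeration partsLE underlying p and N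

length-filter-concatMap : ∀ {B : Set} {P : Pred B 0ℓ} (P? : Decidable P) (h : ℕ → List B) g m →
  length (filter P? (concatMap h (applyUpTo g m))) ≡ Σ m (λ i → length (filter P? (h (g i))))
length-filter-concatMap P? h g zero    = refl
length-filter-concatMap P? h g (suc m) = trans (cong length (filter-++ P? (h (g 0)) _))
  (trans (length-++ (filter P? (h (g 0))))
         (cong (λ t → length (filter P? (h (g 0))) + t) (length-filter-concatMap P? h (λ i → g (suc i)) m)))

length-filter-map : ∀ {A B : Set} {P : Pred B 0ℓ} {Q : Pred A 0ℓ} (P? : Decidable P) (Q? : Decidable Q)
  (f : A → B) (L : List A) → All (λ x → does (P? (f x)) ≡ does (Q? x)) L →
  length (filter P? (map f L)) ≡ length (filter Q? L)
length-filter-map P? Q? f []       []       = refl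
length-filter-map P? Q? f (x ∷ xs) (e ∷ es) rewrite e with does (Q? x)
... | true  = cong suc (length-filter-map P? Q? f xs es)
... | false = length-filter-map P? Q? f xs es

atMost? : ∀ b → Decidable (λ (l : List ℕ) → length l ≤ b)
atMost? b l = length l ≤? b

atMost?-cons : ∀ b k l → does (atMost? (suc b) (k ∷ l)) ≡ does (atMost? b l)
atMost?-cons b k l = does-⇔ (mk⇔ ℕ.s≤s⁻¹ s≤s) (atMost? (suc b) (k ∷ l)) (atMost? b l)

atMost?-zero-cons : ∀ k (L : List (List ℕ)) → length (filter (atMost? 0) (map (k ∷_) L)) ≡ 0
atMost?-zero-cons k []      = refl
atMost?-zero-cons k (_ ∷ L) = atMost?-zero-cons k L

partsLE-length : ∀ f z a → All (λ l → length l ≤ z) (partsLE f z a)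
partsLE-length f       zero    a = z≤n ∷ []
partsLE-length zero    (suc z) a = []
partsLE-length (suc f) (suc z) a = concat⁺ (map⁺ (applyUpTo⁺₁ suc (a ⊓ suc z) (λ {i} _ →
  map⁺ (All.map (λ le → s≤s (≤-trans le (m∸n≤m z i))) (partsLE-length f (z ∸ i) (suc i))))))

partsLE-largest : ∀ f z a → All (λ l → largestPart l ≤ a) (partsLE f z a)
partsLE-largest f       zero    a = z≤n ∷ []
partsLE-largest zero    (suc z) a = []
partsLE-largest (suc f) (suc z) a = concat⁺ (map⁺ (applyUpTo⁺₁ suc (a ⊓ suc z) (λ {i} i< →
  map⁺ (All.map (λ le → ⊔-lub (k≤a i<) (≤-trans le (k≤a i<))) (partsLE-largest f (z ∸ i) (suc i))))))
  where
  k≤a : ∀ {i} → i < a ⊓ suc z → suc i ≤ a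
  k≤a i< = ≤-trans i< (m⊓n≤m a (suc z))

-- The enumeration counts box numbers: partsLE f z a lists the partitions of z
-- with parts at most a, by largest part (this is box-byLargest).
partsLE-count : ∀ f z a b → z ≤ f → length (filter (atMost? b) (partsLE f z a)) ≡ box z 0 a b
partsLE-count f       zero    a b       _ = sym (box-exact 0 a b)
partsLE-count (suc f) (suc z) a zero    _ =
  trans (length-filter-concatMap (atMost? 0) H suc (a ⊓ suc z))
        (trans (Σ-zero (a ⊓ suc z) _ (λ i → atMost?-zero-cons (suc i) (partsLE f (z ∸ i) (suc i))))
               (sym (box-noParts (suc z) 0 a)))
  where
  H : ℕ → List (List ℕ)
  H k = map (k ∷_) (partsLE f (suc z ∸ k) k)
partsLE-count (suc f) (suc z) a (suc b) (s≤s z≤f) = begin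
    length (filter (atMost? (suc b)) (concatMap H (applyUpTo suc (a ⊓ suc z))))
  ≡⟨ length-filter-concatMap (atMost? (suc b)) H suc (a ⊓ suc z) ⟩
    Σ (a ⊓ suc z) (λ i → length (filter (atMost? (suc b)) (H (suc i))))
  ≡⟨ Σ-ext (a ⊓ suc z) (λ i i< → count i (<-≤-trans i< (m⊓n≤n a (suc z)))) ⟩
    Σ (a ⊓ suc z) G
  ≡⟨ Σ-⊓ a (suc z) G (λ i z<i → box-below (suc z) (suc i) (suc i) b (s≤s z<i)) ⟩
    Σ a G
  ≡⟨ box-byLargest (suc z) 0 a b ⟨
    box (suc z) 0 a (suc b) ∎
  where
  open ≡-Reasoning
  H : ℕ → List (List ℕ)
  H k = map (k ∷_) (partsLE f (suc z ∸ k) k)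
  G : ℕ → ℕ
  G i = box (suc z) (suc i) (suc i) b
  count : ∀ i → i < suc z → length (filter (atMost? (suc b)) (H (suc i))) ≡ G i
  count i i<sz = begin
      length (filter (atMost? (suc b)) (H (suc i)))
    ≡⟨ length-filter-map (atMost? (suc b)) (atMost? b) (suc i ∷_) (partsLE f (z ∸ i) (suc i))
         (All.universal (atMost?-cons b (suc i)) _) ⟩
      length (filter (atMost? b) (partsLE f (z ∸ i) (suc i)))
    ≡⟨ partsLE-count f (z ∸ i) (suc i) b (≤-trans (m∸n≤m z i) z≤f) ⟩
      box (z ∸ i) 0 (suc i) b
    ≡⟨ box-rebase (suc i) b i<sz ⟨
      G i ∎

-- p y = box y 0 y y, since no partition of y has more than y parts.
p-box : ∀ y → p y ≡ pBox y
p-box y = trans (cong length (sym (filter-all (atMost? y) (partsLE-length y y y))))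
                (partsLE-count y y y y ≤-refl)

nonNegRank? : Decidable (λ l → 0ℤ ℤ.≤ rank l)
nonNegRank? l = 0ℤ ℤ.≤? rank l

nonNegRank-cons : ∀ i l → largestPart l ≤ suc i → does (nonNegRank? (suc i ∷ l)) ≡ does (atMost? i l)
nonNegRank-cons i l le = does-⇔ (mk⇔ to from) (nonNegRank? (suc i ∷ l)) (atMost? i l)
  where
  largest : suc i ⊔ largestPart l ≡ suc i
  largest = m≥n⇒m⊔n≡m le
  to : 0ℤ ℤ.≤ rank (suc i ∷ l) → length l ≤ i
  to h = ℕ.s≤s⁻¹ (ℤP.drop‿+≤+ (ℤP.0≤i-j⇒j≤i
    (subst (λ t → 0ℤ ℤ.≤ + t ℤ.- + suc (length l)) largest h)))
  from : length l ≤ i → 0ℤ ℤ.≤ rank (suc i ∷ l)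
  from h = subst (λ t → 0ℤ ℤ.≤ + t ℤ.- + suc (length l)) (sym largest) (ℤP.i≤j⇒0≤j-i (ℤ.+≤+ (s≤s h)))

-- N n = N≥ 0 n for n > 0: the enumeration is by largest part i + 1, and such a
-- partition has non-negative rank iff at most i further parts follow.
N-box : ∀ z → N (suc z) ≡ N≥ 0 (suc z)
N-box z = begin
    length (filter nonNegRank? (concatMap H (applyUpTo suc (suc z ⊓ suc z))))
  ≡⟨ length-filter-concatMap nonNegRank? H suc (suc z ⊓ suc z) ⟩
    Σ (suc z ⊓ suc z) F
  ≡⟨ cong (λ M → Σ M F) (⊓-idem (suc z)) ⟩
    Σ (suc z) F
  ≡⟨ Σ-ext (suc z) count ⟩
    Σ (suc z) G
  ≡⟨ Σ-dropLast (suc z) G (box-below (suc z) _ (suc z + 1) (suc z) (m<m+n (suc z) z<s)) ⟨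
    N≥ 0 (suc z) ∎
  where
  open ≡-Reasoning
  H : ℕ → List (List ℕ)
  H k = map (k ∷_) (partsLE z (suc z ∸ k) k)
  F G : ℕ → ℕ
  F i = length (filter nonNegRank? (H (suc i)))
  G j = box (suc z) (j + 1) (j + 1) j
  count : ∀ i → i < suc z → F i ≡ G i
  count i i<sz = begin
      F i
    ≡⟨ length-filter-map nonNegRank? (atMost? i) (suc i ∷_) (partsLE z (z ∸ i) (suc i))
         (All.map (λ {l} → nonNegRank-cons i l) (partsLE-largest z (z ∸ i) (suc i))) ⟩
      length (filter (atMost? i) (partsLE z (z ∸ i) (suc i)))
    ≡⟨ partsLE-count z (z ∸ i) (suc i) i (m∸n≤m z i) ⟩
      box (z ∸ i) 0 (suc i) i
    ≡⟨ box-rebase (suc i) i i<sz ⟨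
      box (suc z) (suc i) (suc i) i
    ≡⟨ cong (λ t → box (suc z) t t i) (+-comm 1 i) ⟩
      G i ∎

-- The alternating sums

⌊+double/2⌋ : ∀ x y → ⌊ x + (y + y) /2⌋ ≡ ⌊ x /2⌋ + y
⌊+double/2⌋ x zero    = trans (cong ⌊_/2⌋ (+-identityʳ x)) (sym (+-identityʳ _))
⌊+double/2⌋ x (suc y) = begin
    ⌊ x + (suc y + suc y) /2⌋  ≡⟨ cong ⌊_/2⌋ (two-more x y) ⟩
    suc ⌊ x + (y + y) /2⌋      ≡⟨ cong suc (⌊+double/2⌋ x y) ⟩
    suc (⌊ x /2⌋ + y)          ≡⟨ +-suc ⌊ x /2⌋ y ⟨
    ⌊ x /2⌋ + suc y            ∎
  where
  open ≡-Reasoning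
  two-more : ∀ x y → x + (suc y + suc y) ≡ suc (suc (x + (y + y)))
  two-more = solve-∀

-- The rank threshold reached after k + 1 terms of the alternating sum.
level : ℕ → ℕ
level k = 3 + 3 * k

level-step : ∀ k → level (suc k) ≡ 3 + level k
level-step = expand
  where
  expand : ∀ k → 3 + 3 * suc k ≡ 3 + (3 + 3 * k)
  expand = solve-∀

g-step : ∀ k → g (suc k) ≡ g k + suc (level k)
g-step k = trans (cong ⌊_/2⌋ (expand k)) (⌊+double/2⌋ (k * (3 * k + 5)) (suc (level k)))
  where
  expand : ∀ k → suc k * (3 * suc k + 5) ≡ k * (3 * k + 5) + (suc (3 + 3 * k) + suc (3 + 3 * k))
  expand = solve-∀

sgn : ℕ → ℤ
sgn k = (ℤ.- 1ℤ) ℤ.^ k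

sgn-square : ∀ k → sgn k ℤ.* sgn k ≡ 1ℤ
sgn-square zero    = refl
sgn-square (suc k) = trans (square (sgn k)) (sgn-square k)
  where
  square : ∀ s → (ℤ.- 1ℤ ℤ.* s) ℤ.* (ℤ.- 1ℤ ℤ.* s) ≡ s ℤ.* s
  square = ℤSolver.solve-∀

shifted-argument : ∀ n a → + n ℤ.- + a ℤ.- 1ℤ ≡ n ⊖ suc a
shifted-argument n a = trans (regroup (+ n) (+ a)) (ℤP.m-n≡m⊖n n (suc a))
  where
  regroup : ∀ x y → x ℤ.- y ℤ.- 1ℤ ≡ x ℤ.- (1ℤ ℤ.+ y)
  regroup = ℤSolver.solve-∀

pℤ-inside : ∀ {n a} → suc a ≤ n → pℤ (+ n ℤ.- + a ℤ.- 1ℤ) ≡ p (n ∸ suc a)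
pℤ-inside {n} {a} a<n = cong pℤ (trans (shifted-argument n a) (ℤP.⊖-≥ a<n))

pℤ-outside : ∀ {n a} → n ≤ a → pℤ (+ n ℤ.- + a ℤ.- 1ℤ) ≡ 0
pℤ-outside {n} {a} n≤a = cong pℤ (trans (shifted-argument n a)
  (trans (ℤP.⊖-< (s≤s n≤a)) (cong (λ t → ℤ.- (+ t)) (+-∸-assoc 1 n≤a))))

cancel : ∀ a {b c} → a + b ≡ c → ℤ.- (+ a) ℤ.+ + c ≡ + b
cancel a {b} {c} a+b≡c = begin
    ℤ.- (+ a) ℤ.+ + c        ≡⟨ cong (λ t → ℤ.- (+ a) ℤ.+ + t) (sym a+b≡c) ⟩
    ℤ.- (+ a) ℤ.+ + (a + b)  ≡⟨ cong (λ t → ℤ.- (+ a) ℤ.+ t) (ℤP.pos-+ a b) ⟩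
    ℤ.- (+ a) ℤ.+ (+ a ℤ.+ + b) ≡⟨ inverse (+ a) (+ b) ⟩
    + b                      ∎
  where
  open ≡-Reasoning
  inverse : ∀ x y → ℤ.- x ℤ.+ (x ℤ.+ y) ≡ y
  inverse = ℤSolver.solve-∀

-- One more term of the alternating sum, in terms of x = n - t - 1:
--   -N≥ m x + p(x - m - 1) = N≥ (m + 3) (x - m - 1),
-- by the key identity when x > m, and as 0 = 0 when x ≤ m.
alternating-step : ∀ m t n →
  ℤ.- (+ N≥ m (n ∸ suc t)) ℤ.+ + pℤ (+ n ℤ.- + (t + suc m) ℤ.- 1ℤ)
    ≡ + N≥ (3 + m) (n ∸ suc (t + suc m))
alternating-step m t n with suc (t + suc m) ≤? n
... | yes inside = begin
    ℤ.- (+ N≥ m (n ∸ suc t)) ℤ.+ + pℤ (+ n ℤ.- + (t + suc m) ℤ.- 1ℤ)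
  ≡⟨ cong₂ (λ u v → ℤ.- (+ N≥ m u) ℤ.+ + v) x≡y+m+1 (trans (pℤ-inside inside) (p-box y)) ⟩
    ℤ.- (+ N≥ m (y + suc m)) ℤ.+ + pBox y
  ≡⟨ cancel (N≥ m (y + suc m)) (key-identity m y) ⟩
    + N≥ (3 + m) y ∎
  where
  open ≡-Reasoning
  y = n ∸ suc (t + suc m)
  regroup : ∀ y t m → y + suc (t + suc m) ≡ y + suc m + suc t
  regroup = solve-∀
  x≡y+m+1 : n ∸ suc t ≡ y + suc m
  x≡y+m+1 = begin
    n ∸ suc t                            ≡⟨ cong (_∸ suc t) (m∸n+n≡m inside) ⟨
    y + suc (t + suc m) ∸ suc t          ≡⟨ cong (_∸ suc t) (regroup y t m) ⟩
    y + suc m + suc t ∸ suc t            ≡⟨ m+n∸n≡m (y + suc m) (suc t) ⟩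
    y + suc m                            ∎
... | no outside = begin
    ℤ.- (+ N≥ m (n ∸ suc t)) ℤ.+ + pℤ (+ n ℤ.- + (t + suc m) ℤ.- 1ℤ)
  ≡⟨ cong₂ (λ u v → ℤ.- (+ u) ℤ.+ + v) (N≥-empty x≤m) (pℤ-outside n≤) ⟩
    0ℤ
  ≡⟨ cong +_ (N≥-empty (≤-trans (≤-reflexive (m≤n⇒m∸n≡0 (m≤n⇒m≤1+n n≤))) z≤n)) ⟨
    + N≥ (3 + m) (n ∸ suc (t + suc m)) ∎
  where
  open ≡-Reasoning
  n≤ : n ≤ t + suc m
  n≤ = ℕ.s≤s⁻¹ (≰⇒> outside)
  x≤m : n ∸ suc t ≤ m
  x≤m = ≤-trans (∸-monoˡ-≤ (suc t) n≤)
                (≤-reflexive (trans (cong (_∸ suc t) (+-suc t m)) (m+n∸m≡n (suc t) m)))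

alternating-sum : ∀ k n → 0 < n → sgn k ℤ.* (S n (suc k) ℤ.- + N n) ≡ + N≥ (level k) (n ∸ suc (g k))
alternating-sum zero (suc z) _ = begin
    1ℤ ℤ.* ((0ℤ ℤ.+ 1ℤ ℤ.* + P) ℤ.- + N (suc z))
  ≡⟨ simplify (+ P) (+ N (suc z)) ⟩
    ℤ.- (+ N (suc z)) ℤ.+ + P
  ≡⟨ cong₂ (λ u v → ℤ.- (+ u) ℤ.+ + v) (N-box z) (trans (pℤ-inside {suc z} {0} (s≤s z≤n)) (p-box z)) ⟩
    ℤ.- (+ N≥ 0 (suc z)) ℤ.+ + pBox z
  ≡⟨ cancel (N≥ 0 (suc z)) (trans (cong (λ t → N≥ 0 t + N≥ 3 z) (+-comm 1 z)) (key-identity 0 z)) ⟩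
    + N≥ 3 z ∎
  where
  open ≡-Reasoning
  P = pℤ (+ suc z ℤ.- + 0 ℤ.- 1ℤ)
  simplify : ∀ P N → 1ℤ ℤ.* ((0ℤ ℤ.+ 1ℤ ℤ.* P) ℤ.- N) ≡ ℤ.- N ℤ.+ P
  simplify = ℤSolver.solve-∀
alternating-sum (suc k) n n>0 = begin
    sgn (suc k) ℤ.* (S n (suc k) ℤ.+ sgn (suc k) ℤ.* + P ℤ.- + N n)
  ≡⟨ flip (sgn k) (S n (suc k)) (+ N n) (+ P) ⟩
    ℤ.- (sgn k ℤ.* (S n (suc k) ℤ.- + N n)) ℤ.+ (sgn k ℤ.* sgn k) ℤ.* + P
  ≡⟨ cong₂ (λ u v → ℤ.- u ℤ.+ v ℤ.* + P) (alternating-sum k n n>0) (sgn-square k) ⟩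
    ℤ.- (+ N≥ (level k) x) ℤ.+ 1ℤ ℤ.* + P
  ≡⟨ cong (λ v → ℤ.- (+ N≥ (level k) x) ℤ.+ v) (ℤP.*-identityˡ (+ P)) ⟩
    ℤ.- (+ N≥ (level k) x) ℤ.+ + P
  ≡⟨ cong (λ t → ℤ.- (+ N≥ (level k) x) ℤ.+ + pℤ (+ n ℤ.- + t ℤ.- 1ℤ)) (g-step k) ⟩
    ℤ.- (+ N≥ (level k) x) ℤ.+ + pℤ (+ n ℤ.- + (g k + suc (level k)) ℤ.- 1ℤ)
  ≡⟨ alternating-step (level k) (g k) n ⟩
    + N≥ (3 + level k) (n ∸ suc (g k + suc (level k)))
  ≡⟨ cong₂ (λ l t → + N≥ l (n ∸ suc t)) (level-step k) (g-step k) ⟨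
    + N≥ (level (suc k)) (n ∸ suc (g (suc k))) ∎
  where
  open ≡-Reasoning
  P = pℤ (+ n ℤ.- + g (suc k) ℤ.- 1ℤ)
  x = n ∸ suc (g k)
  flip : ∀ s S N P → (ℤ.- 1ℤ ℤ.* s) ℤ.* ((S ℤ.+ (ℤ.- 1ℤ ℤ.* s) ℤ.* P) ℤ.- N)
                     ≡ ℤ.- (s ℤ.* (S ℤ.- N)) ℤ.+ (s ℤ.* s) ℤ.* P
  flip = ℤSolver.solve-∀

level-fits : ∀ k n → g (suc k) ℕ.+ 1 ≤ n → suc (level k) ≤ n ∸ suc (g k)
level-fits k n large = ≤-trans (≤-reflexive (sym (m+n∸m≡n (suc (g k)) (suc (level k)))))
  (∸-monoˡ-≤ (suc (g k)) (≤-trans (≤-reflexive g+1) large))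
  where
  g+1 : suc (g k) + suc (level k) ≡ g (suc k) + 1
  g+1 = sym (trans (cong (_+ 1) (g-step k)) (+-comm _ 1))

corollary1p3 : (n k : ℕ) → 0 ℕ.< n → 1 ℕ.≤ k →
    (0ℤ ℤ.≤ (ℤ.- 1ℤ) ℤ.^ (k ∸ 1) ℤ.* (S n k ℤ.- + N n))
    × (g k ℕ.+ 1 ℕ.≤ n → 0ℤ ℤ.< (ℤ.- 1ℤ) ℤ.^ (k ∸ 1) ℤ.* (S n k ℤ.- + N n))
corollary1p3 n (suc k) n>0 _ = nonnegative , positive
  where
  formula : sgn k ℤ.* (S n (suc k) ℤ.- + N n) ≡ + N≥ (level k) (n ∸ suc (g k))
  formula = alternating-sum k n n>0
  nonnegative : 0ℤ ℤ.≤ sgn k ℤ.* (S n (suc k) ℤ.- + N n)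
  nonnegative = subst (0ℤ ℤ.≤_) (sym formula) (ℤ.+≤+ z≤n)
  positive : g (suc k) ℕ.+ 1 ≤ n → 0ℤ ℤ.< sgn k ℤ.* (S n (suc k) ℤ.- + N n)
  positive large = subst (0ℤ ℤ.<_) (sym formula) (ℤ.+<+ (N≥-pos (level-fits k n large)))
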